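{- Let $f$ be a BN with component set $V$, and let $(I_1,I_2)$ be a partition of $V$ into two nonempty parts such that $G(f)$ has no arc from a vertex of $I_2$ to a vertex of $I_1$. Identify $\{0,1\}^V$ with $\{0,1\}^{I_1}\times\{0,1\}^{I_2}$. Let $f^1:\{0,1\}^{I_1}\to\{0,1\}^{I_1}$ be defined by $f^1(x)=f(x,\mathbf 0)_{I_1}$, let $\Gamma^1=\Gamma(f^1)$, and for each $x\in\{0,1\}^{I_1}$ let $f^x:\{0,1\}^{I_2}\to\{0,1\}^{I_2}$ be defined by $f^x(z)=f(x,z)_{I_2}$. For an attractor $A$ of $\Gamma(f)$ set $A^1=\{a_{I_1}:a\in A\}$, $A^2=\{a_{I_2}:a\in A\}$ and $\Gamma^2_A=\bigcup_{x\in A^1}\Gamma(f^x)$. Then for every attractor $A$ of $\Gamma(f)$: (i) $A=A^1\times A^2$; (ii) $A^1$ is an attractor of $\Gamma^1$; (iii) $A^2$ is an attractor of $\Gamma^2_A$.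
   Context: A BN with component set $U$ (finite) is a map $h:\{0,1\}^U\to\{0,1\}^U$. $x_I$ denotes the restriction of a configuration $x$ to $I$, and $\mathbf 0$ the all-zero configuration. $G(f)$ is the signed interaction graph: a positive (negative) arc from $j$ to $i$ iff for some $x$ with $x_j=0$, $f_i(x+e_j)-f_i(x)$ is positive (negative) ($e_j$ = configuration equal to $1$ only at $j$, $+$ mod 2). $\Gamma(h)$ is the digraph on $\{0,1\}^U$ with arcs $x\to x+e_i$ whenever $h_i(x)\neq x_i$; a union of such digraphs has the union of the arc sets. For a digraph on configurations, a trap set has no outgoing arc and an attractor is an inclusion-minimal nonempty trap set. -}

module Defs where

open import Data.Bool using (Bool; true; false; not)
open import Data.Nat using (ℕ; _+_)
open import Data.Fin using (Fin; _↑ˡ_; _↑ʳ_)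
open import Data.Vec using (Vec; lookup; updateAt; take; drop; _++_; replicate)
open import Data.Product using (Σ; ∃; _×_; _,_)
open import Data.Sum using (_⊎_)
open import Level using (0ℓ)
open import Relation.Unary using (Pred; _⊆_)
open import Relation.Binary.PropositionalEquality using (_≡_; _≢_)
open import Relation.Nullary using (¬_)

Config : ℕ → Set
Config n = Vec Bool n

BN : ℕ → Set
BN n = Config n → Config n

flip : ∀ {n} → Config n → Fin n → Config n
flip x i = updateAt x i not

-- Signed interaction graph G(f): positive / negative arc from j to i.
PosArc : ∀ {n} → BN n → Fin n → Fin n → Set
PosArc f j i = ∃ λ x → lookup x j ≡ false × lookup (f x) i ≡ false × lookup (f (flip x j)) i ≡ true

NegArc : ∀ {n} → BN n → Fin n → Fin n → Set
NegArc f j i = ∃ λ x → lookup x j ≡ false × lookup (f x) i ≡ true × lookup (f (flip x j)) i ≡ false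

Arc : ∀ {n} → BN n → Fin n → Fin n → Set
Arc f j i = PosArc f j i ⊎ NegArc f j i

Digraph : ℕ → Set₁
Digraph n = Config n → Config n → Set

Γ : ∀ {n} → BN n → Digraph n
Γ h x y = ∃ λ i → lookup (h x) i ≢ lookup x i × y ≡ flip x i

ConfSet : ℕ → Set₁
ConfSet n = Pred (Config n) 0ℓ

Nonempty : ∀ {n} → ConfSet n → Set
Nonempty T = ∃ λ x → T x

TrapSet : ∀ {n} → Digraph n → ConfSet n → Set
TrapSet D T = ∀ x y → T x → D x y → T y

Attractor : ∀ {n} → Digraph n → ConfSet n → Set₁
Attractor D A = TrapSet D A × Nonempty A ×
  (∀ (B : ConfSet _) → TrapSet D B → Nonempty B → B ⊆ A → A ⊆ B)

-- Setting of the lemma: V = Fin (m + k), I₁ = first m components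
-- (i ↑ˡ k), I₂ = last k components (m ↑ʳ j).
-- {0,1}^V ≅ {0,1}^{I₁} × {0,1}^{I₂} via take/drop and _++_.

NoArcI₂→I₁ : ∀ m k → BN (m + k) → Set
NoArcI₂→I₁ m k f = ∀ (j : Fin k) (i : Fin m) → ¬ Arc f (m ↑ʳ j) (i ↑ˡ k)

f¹ : ∀ m k → BN (m + k) → BN m
f¹ m k f x = take m (f (x ++ replicate k false))

fˣ : ∀ m k → BN (m + k) → Config m → BN k
fˣ m k f x z = drop m (f (x ++ z))

proj¹ : ∀ m k → ConfSet (m + k) → ConfSet m
proj¹ m k A x = ∃ λ a → A a × take m a ≡ x

proj² : ∀ m k → ConfSet (m + k) → ConfSet k
proj² m k A z = ∃ λ a → A a × drop m a ≡ z

Γ² : ∀ m k → BN (m + k) → ConfSet (m + k) → Digraph k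
Γ² m k f A z z' = ∃ λ x → proj¹ m k A x × Γ (fˣ m k f x) z z'

Prod : ∀ m k → ConfSet m → ConfSet k → ConfSet (m + k)
Prod m k P Q a = P (take m a) × Q (drop m a)

-- Since no arc enters I₁ from I₂, the I₁-components of f do not depend on the
-- I₂-part of the configuration.  Hence every step of Γ(f) either is a step of
-- Γ(f¹) on the I₁-part with the I₂-part fixed, or fixes the I₁-part, and every
-- step of Γ(f¹) lifts to Γ(f) with the I₂-part fixed.  An attractor A is
-- strongly connected; projecting a path from a₂ to a₁ onto I₁ and lifting it
-- back with the I₂-part of a₂ frozen shows that (a₁)_{I₁} ++ (a₂)_{I₂} is
-- reachable from a₂, hence lies in A: this is (i).  For (ii) and (iii), the
-- projections of A are trap sets, and the preimage in A of a smaller nonempty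
-- trap set would be a smaller nonempty trap set of Γ(f).
module Submission where

open import Defs
open import Data.Bool using (Bool; true; false; not)
open import Data.Bool.Properties using (not-involutive)
open import Data.Empty using (⊥-elim)
open import Data.Fin using (Fin; zero; suc; _↑ˡ_; _↑ʳ_)
open import Data.Nat using (ℕ; _+_; _≤_)
open import Data.Product using (_×_; _,_; ∃; proj₁; proj₂)
open import Data.Sum using (_⊎_; inj₁; inj₂; [_,_])
open import Data.Vec using ([]; _∷_; lookup; take; drop; _++_; replicate)
open import Data.Vec.Properties
  using (take++drop≡id; ++-injectiveˡ; ++-injectiveʳ; lookup-++ˡ; lookup-++ʳ; updateAt-updateAt-local; updateAt-id)
open import Relation.Binary.Construct.Closure.ReflexiveTransitive using (Star; ε; _◅_; _◅◅_; gmap)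
open import Relation.Binary.PropositionalEquality using (_≡_; _≢_; refl; sym; trans; cong; subst; subst₂)
open import Relation.Unary using (_≐_; _⊆_)
open import Relation.Nullary using (¬_)

flip-involutive : ∀ {n} (x : Config n) (i : Fin n) → flip (flip x i) i ≡ x
flip-involutive x i =
  trans (updateAt-updateAt-local i x (not-involutive (lookup x i))) (updateAt-id i x)

lookup-flip : ∀ {n} (x : Config n) (i : Fin n) → lookup (flip x i) i ≡ not (lookup x i)
lookup-flip (_ ∷ _) zero    = refl
lookup-flip (_ ∷ x) (suc i) = lookup-flip x i

flip-++ˡ : ∀ {m k} (x : Config m) (z : Config k) (i : Fin m) → flip (x ++ z) (i ↑ˡ k) ≡ flip x i ++ z
flip-++ˡ (b ∷ x) z zero    = refl
flip-++ˡ (b ∷ x) z (suc i) = cong (b ∷_) (flip-++ˡ x z i)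

flip-++ʳ : ∀ {m k} (x : Config m) (z : Config k) (j : Fin k) → flip (x ++ z) (m ↑ʳ j) ≡ x ++ flip z j
flip-++ʳ []      z j = refl
flip-++ʳ (b ∷ x) z j = cong (b ∷_) (flip-++ʳ x z j)

take-++ : ∀ {m k} (x : Config m) (z : Config k) → take m (x ++ z) ≡ x
take-++ {m} x z = sym (++-injectiveˡ x (take m (x ++ z)) (sym (take++drop≡id m (x ++ z))))

drop-++ : ∀ {m k} (x : Config m) (z : Config k) → drop m (x ++ z) ≡ z
drop-++ {m} x z = sym (++-injectiveʳ x (take m (x ++ z)) (sym (take++drop≡id m (x ++ z))))

lookup-take : ∀ m {k} (w : Config (m + k)) (i : Fin m) → lookup (take m w) i ≡ lookup w (i ↑ˡ k)
lookup-take m {k} w i =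
  trans (sym (lookup-++ˡ (take m w) (drop m w) i)) (cong (λ v → lookup v (i ↑ˡ k)) (take++drop≡id m w))

lookup-drop : ∀ m {k} (w : Config (m + k)) (j : Fin k) → lookup (drop m w) j ≡ lookup w (m ↑ʳ j)
lookup-drop m {k} w j =
  trans (sym (lookup-++ʳ (take m w) (drop m w) j)) (cong (λ v → lookup v (m ↑ʳ j)) (take++drop≡id m w))

data ++-View (m k : ℕ) : Config (m + k) → Set where
  _++′_ : (x : Config m) (z : Config k) → ++-View m k (x ++ z)

++-view : ∀ m {k} (w : Config (m + k)) → ++-View m k w
++-view m w = subst (++-View m _) (take++drop≡id m w) (take m w ++′ drop m w)

data ↑-View (m k : ℕ) : Fin (m + k) → Set where
  ↑ˡ-view : (i : Fin m) → ↑-View m k (i ↑ˡ k)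
  ↑ʳ-view : (j : Fin k) → ↑-View m k (m ↑ʳ j)

↑-view : ∀ m {k} (i : Fin (m + k)) → ↑-View m k i
↑-view ℕ.zero    i       = ↑ʳ-view i
↑-view (ℕ.suc m) zero    = ↑ˡ-view zero
↑-view (ℕ.suc m) (suc i) with ↑-view m i
... | ↑ˡ-view i′ = ↑ˡ-view (suc i′)
... | ↑ʳ-view j  = ↑ʳ-view j

flip-invariant⇒constant : ∀ {n} (g : Config n → Bool) → (∀ z j → g z ≡ g (flip z j)) → ∀ z z′ → g z ≡ g z′
flip-invariant⇒constant g inv []      []        = refl
flip-invariant⇒constant g inv (b ∷ z) (b′ ∷ z′) =
  trans (flip-invariant⇒constant (λ w → g (b ∷ w)) (λ w j → inv (b ∷ w) (suc j)) z z′) (head b b′)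
  where
  head : ∀ b b′ → g (b ∷ z′) ≡ g (b′ ∷ z′)
  head true  true  = refl
  head false false = refl
  head true  false = inv (true ∷ z′) zero
  head false true  = inv (false ∷ z′) zero

¬Arc⇒flip-invariant₀ : ∀ {n} (f : BN n) {j i : Fin n} → ¬ Arc f j i →
  ∀ x → lookup x j ≡ false → lookup (f x) i ≡ lookup (f (flip x j)) i
¬Arc⇒flip-invariant₀ f {j} {i} no-arc x xj with lookup (f x) i in e | lookup (f (flip x j)) i in e′
... | true  | true  = refl
... | false | false = refl
... | false | true  = ⊥-elim (no-arc (inj₁ (x , xj , e , e′)))
... | true  | false = ⊥-elim (no-arc (inj₂ (x , xj , e , e′)))

¬Arc⇒flip-invariant : ∀ {n} (f : BN n) {j i : Fin n} → ¬ Arc f j i →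
  ∀ x → lookup (f x) i ≡ lookup (f (flip x j)) i
¬Arc⇒flip-invariant f {j} {i} no-arc x with lookup x j in xj
... | false = ¬Arc⇒flip-invariant₀ f no-arc x xj
... | true  = sym (trans (¬Arc⇒flip-invariant₀ f no-arc (flip x j) (trans (lookup-flip x j) (cong not xj)))
                         (cong (λ y → lookup (f y) i) (flip-involutive x j)))

trap-Star : ∀ {n} {D : Digraph n} {T : ConfSet n} → TrapSet D T → ∀ {u v} → T u → Star D u v → T v
trap-Star T-trap Tu ε       = Tu
trap-Star T-trap Tu (s ◅ p) = trap-Star T-trap (T-trap _ _ Tu s) p

Star-trap : ∀ {n} (D : Digraph n) u → TrapSet D (Star D u)
Star-trap D u _ _ p s = p ◅◅ s ◅ ε

attractor-connected : ∀ {n} {D : Digraph n} {A : ConfSet n} → Attractor D A →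
  ∀ {u v} → A u → A v → Star D u v
attractor-connected {D = D} (A-trap , _ , A-min) {u} Au =
  A-min (Star D u) (Star-trap D u) (u , ε) (trap-Star A-trap Au)

Image : ∀ {n p} → (Config n → Config p) → ConfSet n → ConfSet p
Image π A y = ∃ λ a → A a × π a ≡ y

Star-project : ∀ {n p} {D : Digraph n} {E : Digraph p} (π : Config n → Config p) →
  (∀ {a c} → D a c → π a ≡ π c ⊎ E (π a) (π c)) →
  ∀ {u v} → Star D u v → Star E (π u) (π v)
Star-project π split ε = ε
Star-project {E = E} π split {v = v} (s ◅ p) with split s
... | inj₁ eq = subst (λ w → Star E w (π v)) (sym eq) (Star-project π split p)
... | inj₂ t  = t ◅ Star-project π split p

attractor-image : ∀ {n p} {D : Digraph n} {E : Digraph p} (π : Config n → Config p) {A : ConfSet n} →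
  Attractor D A → TrapSet E (Image π A) →
  (∀ a c → A a → D a c → π a ≡ π c ⊎ E (π a) (π c)) →
  Attractor E (Image π A)
attractor-image {n} {D = D} {E} π {A} (A-trap , (a , Aa) , A-min) image-trap split =
  image-trap , (π a , a , Aa , refl) , minimal
  where
  minimal : ∀ B → TrapSet E B → Nonempty B → B ⊆ Image π A → Image π A ⊆ B
  minimal B B-trap (_ , Bb) B⊆image (a′ , Aa′ , refl) = proj₂ (A⊆preimage Aa′)
    where
    preimage : ConfSet n
    preimage a = A a × B (π a)
    preimage-trap : TrapSet D preimage
    preimage-trap a c (Aa , Bπa) s =
      A-trap a c Aa s , [ (λ eq → subst B eq Bπa) , B-trap _ _ Bπa ] (split a c Aa s)
    A⊆preimage : A ⊆ preimage
    A⊆preimage = A-min preimage preimage-trap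
      (let (a , Aa , eq) = B⊆image Bb in a , Aa , subst B (sym eq) Bb) proj₁

module _ {m k : ℕ} (f : BN (m + k)) (no-arc : NoArcI₂→I₁ m k f) where

  f¹-↑ˡ : ∀ (x : Config m) (z : Config k) (i : Fin m) → lookup (f (x ++ z)) (i ↑ˡ k) ≡ lookup (f¹ m k f x) i
  f¹-↑ˡ x z i =
    trans (flip-invariant⇒constant (λ w → lookup (f (x ++ w)) (i ↑ˡ k)) flip-I₂-invariant z (replicate k false))
          (sym (lookup-take m (f (x ++ replicate k false)) i))
    where
    flip-I₂-invariant : ∀ w j → lookup (f (x ++ w)) (i ↑ˡ k) ≡ lookup (f (x ++ flip w j)) (i ↑ˡ k)
    flip-I₂-invariant w j = trans (¬Arc⇒flip-invariant f (no-arc j i) (x ++ w))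
                                  (cong (λ y → lookup (f y) (i ↑ˡ k)) (flip-++ʳ x w j))

  Γ-↑ˡ : ∀ {x x′ : Config m} (z : Config k) → Γ (f¹ m k f) x x′ → Γ f (x ++ z) (x′ ++ z)
  Γ-↑ˡ {x} z (i , x-moves , refl) =
    i ↑ˡ k , subst₂ _≢_ (sym (f¹-↑ˡ x z i)) (sym (lookup-++ˡ x z i)) x-moves , sym (flip-++ˡ x z i)

  Γ-↑ʳ : ∀ (x : Config m) {z z′ : Config k} → Γ (fˣ m k f x) z z′ → Γ f (x ++ z) (x ++ z′)
  Γ-↑ʳ x {z} (j , z-moves , refl) =
    m ↑ʳ j , subst₂ _≢_ (lookup-drop m (f (x ++ z)) j) (sym (lookup-++ʳ x z j)) z-moves , sym (flip-++ʳ x z j)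

  Γ-split : ∀ a c → Γ f a c →
    (Γ (f¹ m k f) (take m a) (take m c) × drop m a ≡ drop m c)
    ⊎ (take m a ≡ take m c × Γ (fˣ m k f (take m a)) (drop m a) (drop m c))
  Γ-split a c s with ++-view m a
  Γ-split _ _ (i , moves , refl) | x ++′ z with ↑-view m i
  ... | ↑ˡ-view i rewrite flip-++ˡ x z i | take-++ x z | drop-++ x z | take-++ (flip x i) z | drop-++ (flip x i) z =
    inj₁ ((i , subst₂ _≢_ (f¹-↑ˡ x z i) (lookup-++ˡ x z i) moves , refl) , refl)
  ... | ↑ʳ-view j rewrite flip-++ʳ x z j | take-++ x z | drop-++ x z | take-++ x (flip z j) | drop-++ x (flip z j) =
    inj₂ (refl , j , subst₂ _≢_ (sym (lookup-drop m (f (x ++ z)) j)) (lookup-++ʳ x z j) moves , refl)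

  take-split : ∀ {a c} → Γ f a c → take m a ≡ take m c ⊎ Γ (f¹ m k f) (take m a) (take m c)
  take-split s = [ (λ (t , _) → inj₂ t) , (λ (eq , _) → inj₁ eq) ] (Γ-split _ _ s)

  module _ {A : ConfSet (m + k)} (A-attractor : Attractor (Γ f) A) where

    A-trap : TrapSet (Γ f) A
    A-trap = proj₁ A-attractor

    attractor-++ : ∀ {a₁ a₂} → A a₁ → A a₂ → A (take m a₁ ++ drop m a₂)
    attractor-++ {a₁} {a₂} Aa₁ Aa₂ =
      trap-Star A-trap Aa₂ (subst (λ w → Star (Γ f) w (take m a₁ ++ drop m a₂)) (take++drop≡id m a₂) lifted-path)
      where
      lifted-path : Star (Γ f) (take m a₂ ++ drop m a₂) (take m a₁ ++ drop m a₂)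
      lifted-path = gmap (_++ drop m a₂) (Γ-↑ˡ (drop m a₂))
                         (Star-project (take m) take-split (attractor-connected A-attractor Aa₂ Aa₁))

    proj-++ : ∀ {x z} → proj¹ m k A x → proj² m k A z → A (x ++ z)
    proj-++ (a₁ , Aa₁ , refl) (a₂ , Aa₂ , refl) = attractor-++ Aa₁ Aa₂

    attractor-product : A ≐ Prod m k (proj¹ m k A) (proj² m k A)
    attractor-product =
      (λ {a} Aa → (a , Aa , refl) , (a , Aa , refl)) ,
      (λ {a} (x , z) → subst A (take++drop≡id m a) (proj-++ x z))

    proj¹-attractor : Attractor (Γ (f¹ m k f)) (proj¹ m k A)
    proj¹-attractor = attractor-image (take m) A-attractor proj¹-trap (λ _ _ _ → take-split)
      where
      proj¹-trap : TrapSet (Γ (f¹ m k f)) (proj¹ m k A)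
      proj¹-trap _ y (a , Aa , refl) s =
        y ++ drop m a , A-trap _ _ (attractor-++ Aa Aa) (Γ-↑ˡ (drop m a) s) , take-++ y (drop m a)

    proj²-attractor : Attractor (Γ² m k f A) (proj² m k A)
    proj²-attractor = attractor-image (drop m) A-attractor proj²-trap drop-split
      where
      proj²-trap : TrapSet (Γ² m k f A) (proj² m k A)
      proj²-trap _ z′ z∈ (x , x∈ , s) = x ++ z′ , A-trap _ _ (proj-++ x∈ z∈) (Γ-↑ʳ x s) , drop-++ x z′
      drop-split : ∀ a c → A a → Γ f a c → drop m a ≡ drop m c ⊎ Γ² m k f A (drop m a) (drop m c)
      drop-split a c Aa s =
        [ (λ (_ , eq) → inj₁ eq) , (λ (_ , t) → inj₂ (take m a , (a , Aa , refl) , t)) ] (Γ-split a c s)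

lemma19 : (m k : ℕ) → 1 ≤ m → 1 ≤ k → (f : BN (m + k)) →
    NoArcI₂→I₁ m k f →
    (A : ConfSet (m + k)) → Attractor (Γ f) A →
    (A ≐ Prod m k (proj¹ m k A) (proj² m k A))
    × Attractor (Γ (f¹ m k f)) (proj¹ m k A)
    × Attractor (Γ² m k f A) (proj² m k A)
lemma19 m k _ _ f no-arc A A-attractor =
  attractor-product f no-arc A-attractor ,
  proj¹-attractor f no-arc A-attractor ,
  proj²-attractor f no-arc A-attractor
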